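{- Let $\mathcal{X}$ and $\mathcal{X}'$ be algebraically isomorphic $\{1,k\}$-schemes, $k>1$. Then $\mathcal{X}$ is Desarguesian if and only if $\mathcal{X}'$ is Desarguesian.
   Context: An association scheme on a finite set $\Omega$ is a pair $(\Omega,S)$ where $S$ is a partition of $\Omega\times\Omega$ with $1_\Omega\in S$, $S^*=S$ ($r^*$ the transpose), and $c_{rs}^t=|\alpha r\cap\beta s^*|$ independent of $(\alpha,\beta)\in t$, where $\alpha r=\{\beta:(\alpha,\beta)\in r\}$. Valency $n_s=|\alpha s|$; a $\{1,k\}$-scheme has all valencies in $\{1,k\}$ with both occurring; $S_k=\{x\in S:n_x=k\}$. Schemes $(\Omega,S)$, $(\Omega',S')$ are algebraically isomorphic if there is a bijection $\varphi:S\to S'$ with $c_{rs}^t=c_{r^\varphi s^\varphi}^{t^\varphi}$ for all $r,s,t\in S$. For $a,b\in S$ the complex product $ab\subseteq S$ is the set of basis relations contained in the composition $a\cdot b$. For $x,y\in S_k$, $x\sim y$ means $c_{xs}^y=1$ for all $s\in x^*y$ (equivalently $|x^*y|=k$); $N(T)=\{y\in S_k:y\sim x\ \forall x\in T\}$. The scheme is Desarguesian if for all $x,y,z\in S_k$ and $r,s\in S$ with $x\sim z\sim y$, $r\in x^*z$, $s\in z^*y$, there exist $q\in N(\{x,y,z\})$, $u,v,w\in S$ and $t\in rs$ with $u\in x^*q$, $v\in y^*q$, $w\in z^*q$, $x^*z\cap uw^*=\{r\}$, $z^*y\cap wv^*=\{s\}$ and $x^*y\cap uv^*=\{t\}$.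 -}

module Defs where

open import Data.Nat using (ℕ; zero; suc)
open import Data.Fin using (Fin; _≟_) renaming (zero to fz; suc to fs)
open import Data.Bool using (Bool; true; false; _∧_)
open import Data.Product using (Σ; _×_; _,_; proj₁; proj₂; ∃; ∃-syntax)
open import Data.Sum using (_⊎_)
open import Relation.Nullary.Decidable using (⌊_⌋)
open import Relation.Binary.PropositionalEquality using (_≡_)
open import Function.Bundles using (_⤖_; _⇔_; Bijection)

count : ∀ {n} → (Fin n → Bool) → ℕ
count {zero}  P = 0
count {suc n} P with P fz
... | true  = suc (count (λ i → P (fs i)))
... | false = count (λ i → P (fs i))

-- |α r ∩ β s*| = #{γ : (α,γ) ∈ r, (γ,β) ∈ s}
-- An association scheme on Ω = Fin n with basis relations indexed by Fin m.
-- rel α β is the (unique) basis relation containing (α,β); thus the classes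
-- rel⁻¹(i) form a partition of Ω×Ω (wit: every class nonempty).
record Scheme : Set where
  field
    n m  : ℕ
    rel  : Fin n → Fin n → Fin m
    wit  : (i : Fin m) → Σ (Fin n × Fin n) λ p → rel (proj₁ p) (proj₂ p) ≡ i
    one      : Fin m
    one-spec : ∀ α β → (rel α β ≡ one) ⇔ (α ≡ β)
    star      : Fin m → Fin m
    star-spec : ∀ α β → rel β α ≡ star (rel α β)

  Ω : Set
  Ω = Fin n

  S : Set
  S = Fin m

  inter : Ω → Ω → S → S → ℕ
  inter α β r s = count (λ γ → ⌊ rel α γ ≟ r ⌋ ∧ ⌊ rel γ β ≟ s ⌋)

  c : S → S → S → ℕ
  c r s t = inter (proj₁ (proj₁ (wit t))) (proj₂ (proj₁ (wit t))) r s

  field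
    c-spec : ∀ r s t α β → rel α β ≡ t → inter α β r s ≡ c r s t

  valency : S → ℕ
  valency s = count (λ β → ⌊ rel (proj₁ (proj₁ (wit s))) β ≟ s ⌋)

  _∈[_·_] : S → S → S → Set
  t ∈[ a · b ] = ∀ α β → rel α β ≡ t → ∃[ γ ] (rel α γ ≡ a × rel γ β ≡ b)

  _∈[_*·_] : S → S → S → Set
  e ∈[ a *· b ] = e ∈[ star a · b ]

  _∈[_·*_] : S → S → S → Set
  e ∈[ a ·* b ] = e ∈[ a · star b ]

  InSk : ℕ → S → Set
  InSk k x = valency x ≡ k

  _∼_ : S → S → Set
  x ∼ y = ∀ s → s ∈[ x *· y ] → c x s y ≡ 1

  InN3 : ℕ → S → S → S → S → Set
  InN3 k x y z q = InSk k q × q ∼ x × q ∼ y × q ∼ z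

OneK : ℕ → Scheme → Set
OneK k X = (∀ s → valency s ≡ 1 ⊎ valency s ≡ k)
         × (∃[ s ] valency s ≡ 1) × (∃[ s ] valency s ≡ k)
  where open Scheme X

Desarguesian : ℕ → Scheme → Set
Desarguesian k X =
  ∀ (x y z : S) → InSk k x → InSk k y → InSk k z →
  ∀ (r s : S) → x ∼ z → z ∼ y → r ∈[ x *· z ] → s ∈[ z *· y ] →
  ∃[ q ] ∃[ u ] ∃[ v ] ∃[ w ] ∃[ t ]
    ( InN3 k x y z q × t ∈[ r · s ]
    × u ∈[ x *· q ] × v ∈[ y *· q ] × w ∈[ z *· q ]
    × (∀ e → (e ∈[ x *· z ] × e ∈[ u ·* w ]) ⇔ (e ≡ r))
    × (∀ e → (e ∈[ z *· y ] × e ∈[ w ·* v ]) ⇔ (e ≡ s))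
    × (∀ e → (e ∈[ x *· y ] × e ∈[ u ·* v ]) ⇔ (e ≡ t)) )
  where open Scheme X

AlgIso : Scheme → Scheme → Set
AlgIso X Y =
  Σ (Scheme.S X ⤖ Scheme.S Y) λ φ →
    let f = Bijection.to φ in
    ∀ r s t → Scheme.c X r s t ≡ Scheme.c Y (f r) (f s) (f t)

-- An algebraic isomorphism preserves every intersection number, and everything
-- the Desarguesian property refers to is determined by intersection numbers:
-- t ∈ ab iff c_{ab}^t ≠ 0, the identity relation is the unique r with 1 ∈ r1,
-- a* is the unique b with 1 ∈ ab, n_s = c_{ss*}^1, and x ∼ y is a condition on
-- the c_{xs}^y. So the property transfers along the isomorphism and back along
-- its inverse.
module Submission where

open import Defs
open import Data.Nat using (ℕ; _<_; zero; suc)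
open import Data.Fin using (Fin; _≟_) renaming (zero to fz; suc to fs)
open import Data.Bool using (Bool; true; false; T; _∧_)
open import Data.Bool.Properties using (T-≡; T-∧)
open import Data.Product using (_×_; _,_; proj₁; ∃; ∃-syntax)
open import Data.Product.Function.NonDependent.Propositional using (_×-⇔_)
open import Data.Empty using (⊥-elim)
open import Function.Base using (_∘_)
open import Function.Bundles using (_⇔_; mk⇔; Equivalence; _↔_; Inverse)
open import Function.Properties.Bijection using (⤖⇒↔)
open import Function.Properties.Inverse using (↔-sym)
open import Relation.Nullary using (¬_; yes; no)
open import Relation.Nullary.Decidable using (⌊_⌋; toWitness; fromWitness)
open import Relation.Binary.PropositionalEquality

open Equivalence using (to; from)

count-cong : ∀ {n} {P Q : Fin n → Bool} → (∀ i → P i ≡ Q i) → count P ≡ count Q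
count-cong {zero}          _   = refl
count-cong {suc n} {P} {Q} P≗Q with P fz | Q fz | P≗Q fz
... | true  | .true  | refl = cong suc (count-cong (P≗Q ∘ fs))
... | false | .false | refl = count-cong (P≗Q ∘ fs)

count≢0⇒∃ : ∀ {n} (P : Fin n → Bool) → ¬ count P ≡ 0 → ∃ (T ∘ P)
count≢0⇒∃ {zero}  P count≢0 = ⊥-elim (count≢0 refl)
count≢0⇒∃ {suc n} P with P fz in Pfz
... | true  = λ _ → fz , from T-≡ Pfz
... | false = λ count≢0 →
  let i , Pfsi = count≢0⇒∃ (P ∘ fs) count≢0 in fs i , Pfsi

∃⇒count≢0 : ∀ {n} (P : Fin n → Bool) {i} → T (P i) → ¬ count P ≡ 0
∃⇒count≢0 {suc n} P {fz}   Pi with P fz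
... | true = λ ()
∃⇒count≢0 {suc n} P {fs i} Pi with P fz
... | true  = λ ()
... | false = ∃⇒count≢0 (P ∘ fs) Pi

module SchemeProperties (X : Scheme) where
  open Scheme X

  one-refl : ∀ α → rel α α ≡ one
  one-refl α = from (one-spec α α) refl

  one⇒≡ : ∀ {α β} → rel α β ≡ one → α ≡ β
  one⇒≡ {α} {β} = to (one-spec α β)

  rel-sym : ∀ {α β a} → rel α β ≡ a → rel β α ≡ star a
  rel-sym {α} {β} αβ≡a = trans (star-spec α β) (cong star αβ≡a)

  inter≢0⇔∃ : ∀ α β a b →
    (¬ inter α β a b ≡ 0) ⇔ (∃[ γ ] (rel α γ ≡ a × rel γ β ≡ b))
  inter≢0⇔∃ α β a b = mk⇔
    (λ ≢0 → let γ , Pγ = count≢0⇒∃ path? ≢0 in γ , to T-path? Pγ)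
    (λ (γ , αγ≡a , γβ≡b) → ∃⇒count≢0 path? (from T-path? (αγ≡a , γβ≡b)))
    where
    path? : Fin n → Bool
    path? γ = ⌊ rel α γ ≟ a ⌋ ∧ ⌊ rel γ β ≟ b ⌋
    T-path? : ∀ {γ} → T (path? γ) ⇔ (rel α γ ≡ a × rel γ β ≡ b)
    T-path? {γ} = mk⇔
      (λ Pγ → let αγ , γβ = to (T-∧ {⌊ rel α γ ≟ a ⌋}) Pγ in toWitness αγ , toWitness γβ)
      (λ (αγ≡a , γβ≡b) → from (T-∧ {⌊ rel α γ ≟ a ⌋}) (fromWitness αγ≡a , fromWitness γβ≡b))

  ∈·⇔c≢0 : ∀ t a b → t ∈[ a · b ] ⇔ (¬ c a b t ≡ 0)
  ∈·⇔c≢0 t a b = mk⇔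
    (λ t∈ab → let (α , β) , αβ≡t = wit t in from (inter≢0⇔∃ α β a b) (t∈ab α β αβ≡t))
    (λ c≢0 α β αβ≡t →
      to (inter≢0⇔∃ α β a b) (c≢0 ∘ trans (sym (c-spec a b t α β αβ≡t))))

  -- Homogeneity: a path of shape (a, b) over a single pair of t gives one over every pair.
  ∈·-intro : ∀ {α β γ t a b} → rel α β ≡ t → rel α γ ≡ a → rel γ β ≡ b → t ∈[ a · b ]
  ∈·-intro {α} {β} {γ} {t} {a} {b} αβ≡t αγ≡a γβ≡b =
    from (∈·⇔c≢0 t a b)
      (from (inter≢0⇔∃ α β a b) (γ , αγ≡a , γβ≡b) ∘ trans (c-spec a b t α β αβ≡t))

  ∈one· : ∀ s → s ∈[ one · s ]
  ∈one· s α β αβ≡s = α , one-refl α , αβ≡s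

  one∈·one⇒≡one : ∀ r → one ∈[ r · one ] → r ≡ one
  one∈·one⇒≡one r one∈r1 =
    let α = proj₁ (proj₁ (wit one))
        γ , αγ≡r , γα≡one = one∈r1 α α (one-refl α)
    in trans (sym αγ≡r) (subst (λ δ → rel α δ ≡ one) (sym (one⇒≡ γα≡one)) (one-refl α))

  one∈·star : ∀ a → one ∈[ a · star a ]
  one∈·star a = let (α , β) , αβ≡a = wit a in ∈·-intro (one-refl α) αβ≡a (rel-sym αβ≡a)

  one∈·⇒≡star : ∀ a b → one ∈[ a · b ] → b ≡ star a
  one∈·⇒≡star a b one∈ab =
    let α = proj₁ (proj₁ (wit one))
        γ , αγ≡a , γα≡b = one∈ab α α (one-refl α)
    in trans (sym γα≡b) (rel-sym αγ≡a)

  valency≡c : ∀ s → valency s ≡ c s (star s) one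
  valency≡c s = trans (count-cong absorb) (c-spec s (star s) one α α (one-refl α))
    where
    α = proj₁ (proj₁ (wit s))
    absorb : ∀ γ → ⌊ rel α γ ≟ s ⌋ ≡ (⌊ rel α γ ≟ s ⌋ ∧ ⌊ rel γ α ≟ star s ⌋)
    absorb γ with rel α γ ≟ s
    ... | no  _    = refl
    ... | yes αγ≡s = sym (to T-≡ (fromWitness (rel-sym αγ≡s)))

DesarguesianWitness : ℕ → (X : Scheme) → (x y z r s q u v w t : Scheme.S X) → Set
DesarguesianWitness k X x y z r s q u v w t =
    InN3 k x y z q × t ∈[ r · s ]
  × u ∈[ x *· q ] × v ∈[ y *· q ] × w ∈[ z *· q ]
  × (∀ e → (e ∈[ x *· z ] × e ∈[ u ·* w ]) ⇔ (e ≡ r))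
  × (∀ e → (e ∈[ z *· y ] × e ∈[ w ·* v ]) ⇔ (e ≡ s))
  × (∀ e → (e ∈[ x *· y ] × e ∈[ u ·* v ]) ⇔ (e ≡ t))
  where open Scheme X

module Transfer (X Y : Scheme) (φ : Scheme.S X ↔ Scheme.S Y)
  (c-preserved : ∀ r s t →
    Scheme.c X r s t ≡ Scheme.c Y (Inverse.to φ r) (Inverse.to φ s) (Inverse.to φ t)) where

  module X = Scheme X
  module Y = Scheme Y
  module PX = SchemeProperties X
  module PY = SchemeProperties Y
  open Inverse φ renaming (to to f; from to f⁻¹) using (strictlyInverseˡ; strictlyInverseʳ)
  open ≡-Reasoning

  c-reflected : ∀ r s t → Y.c r s t ≡ X.c (f⁻¹ r) (f⁻¹ s) (f⁻¹ t)
  c-reflected r s t = begin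
    Y.c r s t                                     ≡⟨ cong₂ (λ a b → Y.c a b t) (sym (strictlyInverseˡ r)) (sym (strictlyInverseˡ s)) ⟩
    Y.c (f (f⁻¹ r)) (f (f⁻¹ s)) t                 ≡⟨ cong (Y.c _ _) (sym (strictlyInverseˡ t)) ⟩
    Y.c (f (f⁻¹ r)) (f (f⁻¹ s)) (f (f⁻¹ t))       ≡⟨ sym (c-preserved _ _ _) ⟩
    X.c (f⁻¹ r) (f⁻¹ s) (f⁻¹ t)                   ∎

  ∀-onto : {P : Y.S → Set} → (∀ a → P (f a)) → ∀ b → P b
  ∀-onto {P} P∘f b = subst P (strictlyInverseˡ b) (P∘f (f⁻¹ b))

  f-injective : ∀ {a b} → f a ≡ f b → a ≡ b
  f-injective {a} {b} fa≡fb = begin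
    a          ≡⟨ sym (strictlyInverseʳ a) ⟩
    f⁻¹ (f a)  ≡⟨ cong f⁻¹ fa≡fb ⟩
    f⁻¹ (f b)  ≡⟨ strictlyInverseʳ b ⟩
    b          ∎

  ∈·-preserved : ∀ t a b → t X.∈[ a · b ] ⇔ f t Y.∈[ f a · f b ]
  ∈·-preserved t a b = mk⇔
    (λ t∈ab → from (PY.∈·⇔c≢0 _ _ _) (to (PX.∈·⇔c≢0 t a b) t∈ab ∘ trans (c-preserved a b t)))
    (λ ft∈fafb → from (PX.∈·⇔c≢0 t a b)
      (to (PY.∈·⇔c≢0 _ _ _) ft∈fafb ∘ trans (sym (c-preserved a b t))))

  one-preserved : f X.one ≡ Y.one
  one-preserved = PY.one∈·one⇒≡one (f X.one)
    (subst (λ o → o Y.∈[ f X.one · o ]) (strictlyInverseˡ Y.one)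
      (to (∈·-preserved _ _ _) (PX.∈one· (f⁻¹ Y.one))))

  star-preserved : ∀ a → f (X.star a) ≡ Y.star (f a)
  star-preserved a = PY.one∈·⇒≡star (f a) (f (X.star a))
    (subst (λ o → o Y.∈[ f a · f (X.star a) ]) one-preserved
      (to (∈·-preserved _ _ _) (PX.one∈·star a)))

  valency-preserved : ∀ s → Y.valency (f s) ≡ X.valency s
  valency-preserved s = begin
    Y.valency (f s)                         ≡⟨ PY.valency≡c (f s) ⟩
    Y.c (f s) (Y.star (f s)) Y.one          ≡⟨ cong₂ (Y.c (f s)) (sym (star-preserved s)) (sym one-preserved) ⟩
    Y.c (f s) (f (X.star s)) (f X.one)      ≡⟨ sym (c-preserved s (X.star s) X.one) ⟩
    X.c s (X.star s) X.one                  ≡⟨ sym (PX.valency≡c s) ⟩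
    X.valency s                             ∎

  InSk-preserved : ∀ k s → X.InSk k s ⇔ Y.InSk k (f s)
  InSk-preserved k s = mk⇔ (trans (valency-preserved s)) (trans (sym (valency-preserved s)))

  ∈*·-preserved : ∀ t a b → t X.∈[ a *· b ] ⇔ f t Y.∈[ f a *· f b ]
  ∈*·-preserved t a b =
    subst (λ a* → t X.∈[ a *· b ] ⇔ f t Y.∈[ a* · f b ]) (star-preserved a)
      (∈·-preserved t (X.star a) b)

  ∈·*-preserved : ∀ t a b → t X.∈[ a ·* b ] ⇔ f t Y.∈[ f a ·* f b ]
  ∈·*-preserved t a b =
    subst (λ b* → t X.∈[ a ·* b ] ⇔ f t Y.∈[ f a · b* ]) (star-preserved b)
      (∈·-preserved t a (X.star b))

  ∼-preserved : ∀ x y → x X.∼ y ⇔ f x Y.∼ f y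
  ∼-preserved x y = mk⇔
    (λ x∼y → ∀-onto λ s s∈ →
      trans (sym (c-preserved x s y)) (x∼y s (from (∈*·-preserved s x y) s∈)))
    (λ fx∼fy s s∈ → trans (c-preserved x s y) (fx∼fy (f s) (to (∈*·-preserved s x y) s∈)))

  InN3-preserved : ∀ k x y z q → X.InN3 k x y z q → Y.InN3 k (f x) (f y) (f z) (f q)
  InN3-preserved k x y z q (kq , q∼x , q∼y , q∼z) =
      to (InSk-preserved k q) kq
    , to (∼-preserved q x) q∼x , to (∼-preserved q y) q∼y , to (∼-preserved q z) q∼z

  unique-preserved : {A : X.S → Set} {B : Y.S → Set} → (∀ e → A e ⇔ B (f e)) →
    ∀ r → (∀ e → A e ⇔ (e ≡ r)) → (∀ e → B e ⇔ (e ≡ f r))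
  unique-preserved {A} {B} A⇔B r A⇔≡r = ∀-onto λ e → mk⇔
    (λ Bfe → cong f (to (A⇔≡r e) (from (A⇔B e) Bfe)))
    (λ fe≡fr → to (A⇔B e) (from (A⇔≡r e) (f-injective fe≡fr)))

  witness-preserved : ∀ {k x y z r s q u v w t} →
    DesarguesianWitness k X x y z r s q u v w t →
    DesarguesianWitness k Y (f x) (f y) (f z) (f r) (f s) (f q) (f u) (f v) (f w) (f t)
  witness-preserved {k} {x} {y} {z} {r} {s} {q} {u} {v} {w} {t}
                    (n3 , t∈rs , u∈ , v∈ , w∈ , r-unique , s-unique , t-unique) =
      InN3-preserved k x y z q n3
    , to (∈·-preserved t r s) t∈rs
    , to (∈*·-preserved u x q) u∈ , to (∈*·-preserved v y q) v∈ , to (∈*·-preserved w z q) w∈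
    , unique-preserved (λ e → ∈*·-preserved e x z ×-⇔ ∈·*-preserved e u w) r r-unique
    , unique-preserved (λ e → ∈*·-preserved e z y ×-⇔ ∈·*-preserved e w v) s s-unique
    , unique-preserved (λ e → ∈*·-preserved e x y ×-⇔ ∈·*-preserved e u v) t t-unique

  desarguesian-preserved : ∀ k → Desarguesian k X → Desarguesian k Y
  desarguesian-preserved k D = ∀-onto λ x → ∀-onto λ y → ∀-onto λ z → λ kx ky kz →
    ∀-onto λ r → ∀-onto λ s → λ x∼z z∼y r∈ s∈ →
    let q , u , v , w , t , W = D x y z
          (from (InSk-preserved k x) kx) (from (InSk-preserved k y) ky)
          (from (InSk-preserved k z) kz) r s
          (from (∼-preserved x z) x∼z) (from (∼-preserved z y) z∼y)
          (from (∈*·-preserved r x z) r∈) (from (∈*·-preserved s z y) s∈)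
    in f q , f u , f v , f w , f t , witness-preserved W

lemma4p4 : (k : ℕ) → 1 < k → (X X' : Scheme) → OneK k X → OneK k X' →
    AlgIso X X' → Desarguesian k X ⇔ Desarguesian k X'
lemma4p4 k _ X X' _ _ (φ , c-preserved) = mk⇔
  (Transfer.desarguesian-preserved X X' ψ c-preserved k)
  (Transfer.desarguesian-preserved X' X (↔-sym ψ) (Transfer.c-reflected X X' ψ c-preserved) k)
  where
  ψ : Scheme.S X ↔ Scheme.S X'
  ψ = ⤖⇒↔ φ
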